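{- For every integer $n\ge 2$, the quadrilateral snake $S_{4,n}$ is neighborhood-prime.
   Context: A neighborhood-prime labeling of a simple graph $G$ with $N$ vertices is a bijection $f:V(G)\to\{1,\ldots,N\}$ such that for every vertex $v$ with $\deg(v)>1$, $\gcd\{f(u):u\in N(v)\}=1$, where $N(v)$ is the neighborhood of $v$; a graph admitting one is neighborhood-prime. The quadrilateral snake $S_{4,n}$ is obtained from a path $u_1,\ldots,u_n$ by adding, for each $i=1,\ldots,n-1$, two new vertices $v_i,w_i$ and the edges forming the path $u_i,v_i,w_i,u_{i+1}$ (so each consecutive pair $u_i,u_{i+1}$ lies on a 4-cycle). -}

module Defs where

open import Data.Nat using (ℕ; zero; suc; _+_; _*_; _∸_; _<_; _≡ᵇ_)
open import Data.Nat.GCD using (gcd)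
open import Data.Nat.DivMod using (_%_)
open import Data.Bool using (Bool; true; false; _∨_; _∧_; T)
open import Data.Fin using (Fin; toℕ)
open import Data.List using (List; filter; allFin; map; foldr; length)
open import Function.Bundles using (_⤖_; Bijection)
open import Relation.Binary.PropositionalEquality using (_≡_)
open import Relation.Nullary.Decidable using (T?)
open import Data.Product using (Σ)
open import Data.Bool.Properties using (∨-comm; ∧-zeroʳ)
open import Relation.Binary.PropositionalEquality using (cong₂; refl)

record SimpleGraph : Set where
  field
    N     : ℕ
    adj   : Fin N → Fin N → Bool
    sym   : ∀ x y → adj x y ≡ adj y x
    irrefl : ∀ x → adj x x ≡ false

open SimpleGraph public

nbhd : (G : SimpleGraph) → Fin (N G) → List (Fin (N G))
nbhd G v = filter (λ u → T? (adj G v u)) (allFin (N G))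

degree : (G : SimpleGraph) → Fin (N G) → ℕ
degree G v = length (nbhd G v)

-- gcd of a finite list of naturals (gcd of the empty list is 0).
gcdList : List ℕ → ℕ
gcdList = foldr gcd 0

-- A labeling is a bijection f : V(G) → {1,…,N}; we encode {1,…,N} as Fin N
-- with the vertex labelled by  suc (toℕ (f v)).
label : {n : ℕ} → (Fin n ⤖ Fin n) → Fin n → ℕ
label f v = suc (toℕ (Bijection.to f v))

IsNeighborhoodPrimeLabeling : (G : SimpleGraph) → (Fin (N G) ⤖ Fin (N G)) → Set
IsNeighborhoodPrimeLabeling G f =
  ∀ (v : Fin (N G)) → 1 < degree G v →
    gcdList (map (label f) (nbhd G v)) ≡ 1

NeighborhoodPrime : SimpleGraph → Set
NeighborhoodPrime G = Σ (Fin (N G) ⤖ Fin (N G)) (IsNeighborhoodPrimeLabeling G)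

-- Vertex numbering (0-based, on ℕ, vertex set {0,…,3n-3} = Fin (3n ∸ 2)):
--   u_i ↦ 3(i-1)        (i = 1,…,n)
--   v_i ↦ 3(i-1) + 1    (i = 1,…,n-1)
--   w_i ↦ 3(i-1) + 2    (i = 1,…,n-1)
-- Edges: the path u_1,u_2,…,u_n  (3j -- 3j+3)  and the paths
-- u_i,v_i,w_i,u_{i+1}  (3j -- 3j+1 -- 3j+2 -- 3j+3), i.e. all pairs of
-- consecutive numbers, plus pairs {3j, 3j+3}.

snakeAdjℕ : ℕ → ℕ → Bool
snakeAdjℕ a b =
  ((suc a ≡ᵇ b) ∨ (suc b ≡ᵇ a)) ∨
  (((a % 3 ≡ᵇ 0) ∧ (a + 3 ≡ᵇ b)) ∨ ((b % 3 ≡ᵇ 0) ∧ (b + 3 ≡ᵇ a)))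

snakeAdjℕ-sym : ∀ a b → snakeAdjℕ a b ≡ snakeAdjℕ b a
snakeAdjℕ-sym a b =
  cong₂ _∨_ (∨-comm (suc a ≡ᵇ b) (suc b ≡ᵇ a))
            (∨-comm ((a % 3 ≡ᵇ 0) ∧ (a + 3 ≡ᵇ b)) ((b % 3 ≡ᵇ 0) ∧ (b + 3 ≡ᵇ a)))

private
  suc≢ᵇ : ∀ a → (suc a ≡ᵇ a) ≡ false
  suc≢ᵇ zero = refl
  suc≢ᵇ (suc a) = suc≢ᵇ a

  +3≢ᵇ : ∀ a → (a + 3 ≡ᵇ a) ≡ false
  +3≢ᵇ zero = refl
  +3≢ᵇ (suc a) = +3≢ᵇ a

snakeAdjℕ-irrefl : ∀ a → snakeAdjℕ a a ≡ false
snakeAdjℕ-irrefl a rewrite suc≢ᵇ a | +3≢ᵇ a | ∧-zeroʳ (a % 3 ≡ᵇ 0) = refl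

-- S_{4,n} has n + 2(n-1) = 3n - 2 vertices.
S4 : ℕ → SimpleGraph
S4 n = record
  { N = 3 * n ∸ 2
  ; adj = λ x y → snakeAdjℕ (toℕ x) (toℕ y)
  ; sym = λ x y → snakeAdjℕ-sym (toℕ x) (toℕ y)
  ; irrefl = λ x → snakeAdjℕ-irrefl (toℕ x)
  }

-- Keep the natural order u_1, v_1, w_1, u_2, … but exchange the labels of v_i
-- and w_i, so that u_i, w_i, v_i receive 3i-2, 3i-1, 3i.  Then every vertex has
-- two neighbours with consecutive labels (u_i, w_i for v_i; v_i, u_{i+1} for u_i
-- and w_i; u_{n-1}, w_{n-1} for u_n), and two consecutive integers in a
-- neighbourhood force its gcd to be 1.
module Submission where

open import Defs hiding (sym)
open import Data.Nat using (ℕ; zero; suc; _+_; _*_; _∸_; _<_; _≤_; z≤n; s≤s)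
open import Data.Nat.Properties using (*-comm; +-comm)
open import Data.Nat.DivMod using (_%_; [m+n]%n≡m%n)
open import Data.Nat.Divisibility using (_∣_; ∣-trans; ∣1⇒≡1; ∣m+n∣m⇒∣n)
open import Data.Nat.GCD using (gcd[m,n]∣m; gcd[m,n]∣n)
open import Data.Bool using (true; T)
open import Data.Fin using (Fin; toℕ; fromℕ<)
open import Data.Fin.Properties using (toℕ-fromℕ<; toℕ-injective; toℕ<n)
open import Data.List using (_∷_; map)
open import Data.List.Membership.Propositional using (_∈_)
open import Data.List.Relation.Unary.Any using (here; there)
open import Data.List.Membership.Propositional.Properties using (∈-filter⁺; ∈-allFin; ∈-map⁺)
open import Data.Product using (_,_)
open import Function.Base using (_∘_)
open import Function.Bundles using (_⤖_; mk↔ₛ′)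
open import Function.Properties.Inverse using (↔⇒⤖)
open import Relation.Binary.PropositionalEquality
  using (_≡_; refl; cong; trans; subst; sym; module ≡-Reasoning)
open import Relation.Nullary.Decidable using (T?)

gcdList-∣ : ∀ {x} xs → x ∈ xs → gcdList xs ∣ x
gcdList-∣ (y ∷ ys) (here refl) = gcd[m,n]∣m y (gcdList ys)
gcdList-∣ (y ∷ ys) (there x∈ys) = ∣-trans (gcd[m,n]∣n y (gcdList ys)) (gcdList-∣ ys x∈ys)

gcdList-consecutive≡1 : ∀ {m} xs → m ∈ xs → suc m ∈ xs → gcdList xs ≡ 1
gcdList-consecutive≡1 {m} xs m∈xs 1+m∈xs =
  ∣1⇒≡1 (∣m+n∣m⇒∣n (subst (gcdList xs ∣_) (+-comm 1 m) (gcdList-∣ xs 1+m∈xs))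
                    (gcdList-∣ xs m∈xs))

module _ (G : SimpleGraph) where

  ∈-nbhd : ∀ {v u} → adj G v u ≡ true → u ∈ nbhd G v
  ∈-nbhd {v} v~u = ∈-filter⁺ (λ u → T? (adj G v u)) (∈-allFin _) (subst T (sym v~u) _)

  gcd-nbhd-consecutive≡1 : ∀ (f : Fin (N G) ⤖ Fin (N G)) {v u w} →
    adj G v u ≡ true → adj G v w ≡ true → label f w ≡ suc (label f u) →
    gcdList (map (label f) (nbhd G v)) ≡ 1
  gcd-nbhd-consecutive≡1 f {v} v~u v~w fw≡1+fu =
    gcdList-consecutive≡1 labels
      (∈-map⁺ (label f) (∈-nbhd {v} v~u))
      (subst (_∈ labels) fw≡1+fu (∈-map⁺ (label f) (∈-nbhd {v} v~w)))
    where labels = map (label f) (nbhd G v)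

module _ {M} (f : ℕ → ℕ) (f-< : ∀ {x} → x < M → f x < M) (f-involutive : ∀ x → f (f x) ≡ x) where

  restrictFin : Fin M → Fin M
  restrictFin x = fromℕ< (f-< (toℕ<n x))

  toℕ-restrictFin : ∀ x → toℕ (restrictFin x) ≡ f (toℕ x)
  toℕ-restrictFin x = toℕ-fromℕ< _

  restrictFin-involutive : ∀ x → restrictFin (restrictFin x) ≡ x
  restrictFin-involutive x = toℕ-injective (begin
    toℕ (restrictFin (restrictFin x)) ≡⟨ toℕ-restrictFin (restrictFin x) ⟩
    f (toℕ (restrictFin x))           ≡⟨ cong f (toℕ-restrictFin x) ⟩
    f (f (toℕ x))                     ≡⟨ f-involutive (toℕ x) ⟩
    toℕ x                             ∎)
    where open ≡-Reasoning

  involution⇒⤖ : Fin M ⤖ Fin M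
  involution⇒⤖ = ↔⇒⤖ (mk↔ₛ′ restrictFin restrictFin restrictFin-involutive restrictFin-involutive)

  label-involution⇒⤖ : ∀ x → label involution⇒⤖ x ≡ suc (f (toℕ x))
  label-involution⇒⤖ x = cong suc (toℕ-restrictFin x)

-- Exchanges the numbers 3j+1 = v_{j+1} and 3j+2 = w_{j+1}.
swap12 : ℕ → ℕ
swap12 0 = 0
swap12 1 = 2
swap12 2 = 1
swap12 (suc (suc (suc x))) = 3 + swap12 x

swap12-involutive : ∀ x → swap12 (swap12 x) ≡ x
swap12-involutive 0 = refl
swap12-involutive 1 = refl
swap12-involutive 2 = refl
swap12-involutive (suc (suc (suc x))) = cong (3 +_) (swap12-involutive x)

swap12-< : ∀ m {x} → x < suc (m * 3) → swap12 x < suc (m * 3)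
swap12-< m {0} x<1+3m = x<1+3m
swap12-< zero {suc x} (s≤s ())
swap12-< (suc m) {1} _ = s≤s (s≤s (s≤s z≤n))
swap12-< (suc m) {2} _ = s≤s (s≤s z≤n)
swap12-< (suc m) {suc (suc (suc x))} (s≤s (s≤s (s≤s x<1+3m))) =
  s≤s (s≤s (s≤s (swap12-< m x<1+3m)))

[3+m]%3≡m%3 : ∀ m → (3 + m) % 3 ≡ m % 3
[3+m]%3≡m%3 m = trans (cong (_% 3) (+-comm 3 m)) ([m+n]%n≡m%n m 3)

snakeAdjℕ-+3 : ∀ a b → snakeAdjℕ (3 + a) (3 + b) ≡ snakeAdjℕ a b
snakeAdjℕ-+3 a b rewrite [3+m]%3≡m%3 a | [3+m]%3≡m%3 b = refl

record ConsecutivelyLabelledNeighbours (M t : ℕ) : Set where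
  constructor neighbours
  field
    {a b} : ℕ
    a<M : a < M
    b<M : b < M
    t~a : snakeAdjℕ t a ≡ true
    t~b : snakeAdjℕ t b ≡ true
    swap12-b≡1+swap12-a : swap12 b ≡ suc (swap12 a)

-- S_{4,2+k} has vertices 0 … 3(1+k); the pattern of the first block repeats
-- every three vertices, except at the last vertex u_n (the case t = 3, k = 0).
consecutivelyLabelledNeighbours : ∀ k {t} → t < suc (suc k * 3) →
  ConsecutivelyLabelledNeighbours (suc (suc k * 3)) t
consecutivelyLabelledNeighbours k {0} _ =
  neighbours {a = 1} {b = 3} (s≤s (s≤s z≤n)) (s≤s (s≤s (s≤s (s≤s z≤n)))) refl refl refl
consecutivelyLabelledNeighbours k {1} _ =
  neighbours {a = 0} {b = 2} (s≤s z≤n) (s≤s (s≤s (s≤s z≤n))) refl refl refl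
consecutivelyLabelledNeighbours k {2} _ =
  neighbours {a = 1} {b = 3} (s≤s (s≤s z≤n)) (s≤s (s≤s (s≤s (s≤s z≤n)))) refl refl refl
consecutivelyLabelledNeighbours zero {3} _ =
  neighbours {a = 0} {b = 2} (s≤s z≤n) (s≤s (s≤s (s≤s z≤n))) refl refl refl
consecutivelyLabelledNeighbours zero {suc (suc (suc (suc t)))} (s≤s (s≤s (s≤s (s≤s ()))))
consecutivelyLabelledNeighbours (suc k) {suc (suc (suc t))} (s≤s (s≤s (s≤s t<M)))
  with neighbours {a} {b} a<M b<M t~a t~b b≡1+a ← consecutivelyLabelledNeighbours k t<M =
  neighbours (+3-< a<M) (+3-< b<M)
    (trans (snakeAdjℕ-+3 t a) t~a) (trans (snakeAdjℕ-+3 t b) t~b) (cong (3 +_) b≡1+a)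
  where
  +3-< : ∀ {x} → x < suc (suc k * 3) → 3 + x < suc (suc (suc k) * 3)
  +3-< x<M = s≤s (s≤s (s≤s x<M))

S4-vertexCount : ∀ m → N (S4 (suc m)) ≡ suc (m * 3)
S4-vertexCount m = cong (_∸ 2) (*-comm 3 (suc m))

module _ (k : ℕ) where

  private
    n : ℕ
    n = suc (suc k)

    toBound : ∀ {x} → x < N (S4 n) → x < suc (suc k * 3)
    toBound {x} = subst (x <_) (S4-vertexCount (suc k))

    fromBound : ∀ {x} → x < suc (suc k * 3) → x < N (S4 n)
    fromBound {x} = subst (x <_) (sym (S4-vertexCount (suc k)))

    vertex : ∀ {x} → x < suc (suc k * 3) → Fin (N (S4 n))
    vertex x<M = fromℕ< (fromBound x<M)

    toℕ-vertex : ∀ {x} (x<M : x < suc (suc k * 3)) → toℕ (vertex x<M) ≡ x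
    toℕ-vertex x<M = toℕ-fromℕ< (fromBound x<M)

    swap12-<N : ∀ {x} → x < N (S4 n) → swap12 x < N (S4 n)
    swap12-<N x<N = fromBound (swap12-< (suc k) (toBound x<N))

  swap12Labelling : Fin (N (S4 n)) ⤖ Fin (N (S4 n))
  swap12Labelling = involution⇒⤖ swap12 swap12-<N swap12-involutive

  swap12Labelling-isNeighborhoodPrime : IsNeighborhoodPrimeLabeling (S4 n) swap12Labelling
  swap12Labelling-isNeighborhoodPrime v _
    with neighbours {a} {b} a<M b<M v~a v~b b≡1+a ← consecutivelyLabelledNeighbours k (toBound (toℕ<n v)) =
    gcd-nbhd-consecutive≡1 (S4 n) swap12Labelling {v} {vertex a<M} {vertex b<M}
      (trans (cong (snakeAdjℕ (toℕ v)) (toℕ-vertex a<M)) v~a)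
      (trans (cong (snakeAdjℕ (toℕ v)) (toℕ-vertex b<M)) v~b)
      (begin
        label swap12Labelling (vertex b<M) ≡⟨ labelled b<M ⟩
        suc (swap12 b)                     ≡⟨ cong suc b≡1+a ⟩
        suc (suc (swap12 a))               ≡⟨ cong suc (sym (labelled a<M)) ⟩
        suc (label swap12Labelling (vertex a<M)) ∎)
    where
    open ≡-Reasoning
    labelled : ∀ {x} (x<M : x < suc (suc k * 3)) → label swap12Labelling (vertex x<M) ≡ suc (swap12 x)
    labelled x<M = trans (label-involution⇒⤖ swap12 swap12-<N swap12-involutive (vertex x<M))
                         (cong (suc ∘ swap12) (toℕ-vertex x<M))

mainTheorem3 : (n : ℕ) → 2 ≤ n → NeighborhoodPrime (S4 n)
mainTheorem3 (suc (suc k)) (s≤s (s≤s z≤n)) =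
  swap12Labelling k , swap12Labelling-isNeighborhoodPrime k
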